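{- There exists a $\mathrm{HyperQPTL}$ sentence $\varphi$ that is satisfiable (i.e., some nonempty set of traces is a model of $\varphi$) and such that every model $T$ of $\varphi$ has cardinality $\mathfrak{c}$, the cardinality of the continuum.
   Context: Let $\mathrm{AP}$ be a nonempty finite set of atomic propositions. A trace over $\mathrm{AP}$ is an infinite word $t=t(0)t(1)\cdots$ over the alphabet $2^{\mathrm{AP}}$. Let $\mathcal{V}$ be a countable set of trace variables. $\mathrm{HyperQPTL}$ formulas are given by the grammar $\phi ::= \exists \pi.\,\phi \mid \forall \pi.\,\phi \mid \exists q.\,\phi \mid \forall q.\,\phi \mid \psi$, $\psi ::= p_\pi \mid q \mid \neg\psi \mid \psi\vee\psi \mid \mathbf{X}\psi \mid \mathbf{F}\psi$, with $p,q\in\mathrm{AP}$ and $\pi\in\mathcal{V}$ (other Boolean connectives and $\mathbf{G}$, $\mathbf{U}$ are derived). A sentence is a formula in which every $p_\pi$ lies in the scope of a quantifier binding $\pi$ and every unlabeled $q$ lies in the scope of a quantifier binding $q$. For a trace $t$ over $\mathrm{AP}$ and a trace $t_q$ over $\{q\}$, $t[q\mapsto t_q]$ is the trace obtained from $t$ by replacing, at every position $n$, the truth value of $q$ by that in $t_q(n)$; for a set $T$ of traces, $T[q\mapsto t_q]=\{t[q\mapsto t_q]\mid t\in T\}$. For a set $T$ of traces, a partial map $\Pi:\mathcal{V}\to(2^{\mathrm{AP}})^\omega$ and $i\in\mathbb{N}$: $T,\Pi,i\models p_\pi$ iff $p\in\Pi(\pi)(i)$; $T,\Pi,i\models q$ iff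 $q\in t(i)$ for all $t\in T$; negation and disjunction are as usual; $T,\Pi,i\models\mathbf{X}\psi$ iff $T,\Pi,i+1\models\psi$; $T,\Pi,i\models\mathbf{F}\psi$ iff $T,\Pi,i'\models\psi$ for some $i'\ge i$; $T,\Pi,i\models\exists\pi.\phi$ (resp. $\forall\pi.\phi$) iff for some (resp. all) $t\in T$, $T,\Pi[\pi\mapsto t],i\models\phi$; $T,\Pi,i\models\exists q.\phi$ (resp. $\forall q.\phi$) iff for some (resp. all) traces $t_q\in(2^{\{q\}})^\omega$, $T[q\mapsto t_q],\Pi,i\models\phi$. A nonempty set $T$ of traces is a model of a sentence $\phi$ ($T\models\phi$) if $T,\Pi_\emptyset,0\models\phi$ with $\Pi_\emptyset$ the empty assignment. -}

module Defs where

open import Data.Nat using (ℕ; zero; suc; _≤_; _+_)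
open import Data.Fin using (Fin; _≟_)
open import Data.Bool using (Bool; true; false; if_then_else_)
open import Data.List using (List; []; _∷_)
open import Data.List.Membership.Propositional using (_∈_)
open import Data.Maybe using (Maybe; just; nothing)
open import Data.Product using (Σ; _×_; _,_; proj₁; proj₂; ∃)
open import Data.Sum using (_⊎_)
open import Data.Empty using (⊥)
open import Relation.Nullary using (¬_; does)
open import Relation.Binary.PropositionalEquality using (_≡_)

-- Atomic propositions: AP = Fin k (finite; nonempty when k = suc n).
-- Trace variables: 𝒱 = ℕ (countable).
Var : Set
Var = ℕ

Trace : ℕ → Set
Trace k = ℕ → Fin k → Bool

-- A trace over {q}.
QTrace : Set
QTrace = ℕ → Bool

TraceSet : ℕ → Set₁
TraceSet k = Trace k → Set

data Body (k : ℕ) : Set where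
  prop  : Fin k → Var → Body k
  qvar  : Fin k → Body k
  neg   : Body k → Body k
  or    : Body k → Body k → Body k
  next  : Body k → Body k
  event : Body k → Body k

data Formula (k : ℕ) : Set where
  ∃π   : Var → Formula k → Formula k
  ∀π   : Var → Formula k → Formula k
  ∃q   : Fin k → Formula k → Formula k
  ∀q   : Fin k → Formula k → Formula k
  body : Body k → Formula k

BodyScoped : ∀ {k} → List Var → List (Fin k) → Body k → Set
BodyScoped V Q (prop p π) = π ∈ V
BodyScoped V Q (qvar q)   = q ∈ Q
BodyScoped V Q (neg ψ)    = BodyScoped V Q ψ
BodyScoped V Q (or ψ ψ')  = BodyScoped V Q ψ × BodyScoped V Q ψ'
BodyScoped V Q (next ψ)   = BodyScoped V Q ψ
BodyScoped V Q (event ψ)  = BodyScoped V Q ψ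

Scoped : ∀ {k} → List Var → List (Fin k) → Formula k → Set
Scoped V Q (∃π π φ) = Scoped (π ∷ V) Q φ
Scoped V Q (∀π π φ) = Scoped (π ∷ V) Q φ
Scoped V Q (∃q q φ) = Scoped V (q ∷ Q) φ
Scoped V Q (∀q q φ) = Scoped V (q ∷ Q) φ
Scoped V Q (body ψ) = BodyScoped V Q ψ

Sentence : ∀ {k} → Formula k → Set
Sentence φ = Scoped [] [] φ

update : ∀ {k} → Trace k → Fin k → QTrace → Trace k
update t q tq n a = if does (a ≟ q) then tq n else t n a

updateSet : ∀ {k} → TraceSet k → Fin k → QTrace → TraceSet k
updateSet T q tq t' = Σ (Trace _) λ t → T t × (∀ n a → t' n a ≡ update t q tq n a)

Assignment : ℕ → Set
Assignment k = Var → Maybe (Trace k)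

emptyAssign : ∀ {k} → Assignment k
emptyAssign _ = nothing

extend : ∀ {k} → Assignment k → Var → Trace k → Assignment k
extend Π π t π' with does (Data.Nat._≟_ π' π)
... | true  = just t
... | false = Π π'

lookupHolds : ∀ {k} → Maybe (Trace k) → Fin k → ℕ → Set
lookupHolds nothing  p i = ⊥
lookupHolds (just t) p i = t i p ≡ true

_,_,_⊨ᵇ_ : ∀ {k} → TraceSet k → Assignment k → ℕ → Body k → Set
T , Π , i ⊨ᵇ prop p π = lookupHolds (Π π) p i
T , Π , i ⊨ᵇ qvar q   = ∀ t → T t → t i q ≡ true
T , Π , i ⊨ᵇ neg ψ    = ¬ (T , Π , i ⊨ᵇ ψ)
T , Π , i ⊨ᵇ or ψ ψ'  = (T , Π , i ⊨ᵇ ψ) ⊎ (T , Π , i ⊨ᵇ ψ')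
T , Π , i ⊨ᵇ next ψ   = T , Π , suc i ⊨ᵇ ψ
T , Π , i ⊨ᵇ event ψ  = Σ ℕ λ j → (i ≤ j) × (T , Π , j ⊨ᵇ ψ)

_,_,_⊨_ : ∀ {k} → TraceSet k → Assignment k → ℕ → Formula k → Set
T , Π , i ⊨ ∃π π φ = Σ (Trace _) λ t → T t × (T , extend Π π t , i ⊨ φ)
T , Π , i ⊨ ∀π π φ = ∀ t → T t → T , extend Π π t , i ⊨ φ
T , Π , i ⊨ ∃q q φ = Σ QTrace λ tq → updateSet T q tq , Π , i ⊨ φ
T , Π , i ⊨ ∀q q φ = ∀ (tq : QTrace) → updateSet T q tq , Π , i ⊨ φ
T , Π , i ⊨ body ψ = T , Π , i ⊨ᵇ ψ

Model : ∀ {k} → TraceSet k → Formula k → Set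
Model T φ = (Σ (Trace _) T) × (T , emptyAssign , 0 ⊨ φ)

Elem : ∀ {k} → TraceSet k → Set
Elem T = Σ (Trace _) T

_≈ᵉ_ : ∀ {k} {T : TraceSet k} → Elem T → Elem T → Set
x ≈ᵉ y = ∀ n a → proj₁ x n a ≡ proj₁ y n a

_≈ᶜ_ : (ℕ → Bool) → (ℕ → Bool) → Set
f ≈ᶜ g = ∀ n → f n ≡ g n

-- |T| = 𝔠 : a bijection (of setoids, extensional equality) between T and 2^ℕ.
record HasCardContinuum {k} (T : TraceSet k) : Set where
  field
    to      : Elem T → (ℕ → Bool)
    from    : (ℕ → Bool) → Elem T
    to-cong   : ∀ {x y} → x ≈ᵉ y → to x ≈ᶜ to y
    from-cong : ∀ {f g} → f ≈ᶜ g → from f ≈ᵉ from g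
    to-from : ∀ f → to (from f) ≈ᶜ f
    from-to : ∀ x → from (to x) ≈ᵉ x

-- Take φ = ∀π. ∀q. ∃π'. G ¬q_π ∧ G (p_π' ↔ q).  The conjunct G ¬q_π forces q
-- to be false on every trace of a model, so a trace of a model is determined by
-- its p-component.  In T[q ↦ t_q] the unlabelled q holds exactly at the
-- positions where t_q does, so the conjunct G (p_π' ↔ q) demands, for every
-- t_q ∈ 2^ℕ, a trace of T whose p-component is t_q.  Hence p-components give a
-- bijection between any model and 2^ℕ, and the set of all traces on which q is
-- constantly false is a model.
module Submission where

open import Defs
open import Data.Nat using (ℕ; suc; _≤_; z≤n)
open import Data.Fin using (Fin; zero; suc; _≟_)
open import Data.Bool using (Bool; true; false; not; _∨_)
open import Data.Bool.Properties using (not-injective) renaming (_≟_ to _≟ᴮ_)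
open import Data.Empty using (⊥-elim)
open import Data.Maybe using (just)
open import Data.Product using (Σ; _×_; _,_; proj₁; proj₂)
open import Data.Sum using (inj₁; inj₂; [_,_])
open import Data.List.Relation.Unary.Any using (here; there)
open import Function using (_∘_)
open import Function.Bundles using (_⇔_; mk⇔; Equivalence)
open import Function.Properties.Equivalence using () renaming (refl to ⇔-refl; trans to ⇔-trans)
open import Relation.Nullary using (¬_; Dec)
open import Relation.Nullary.Decidable using (decidable-stable; dec-true)
open import Relation.Binary.PropositionalEquality using (_≡_; refl; sym; trans; cong; subst)

open Equivalence using (to; from)

false≢true : ¬ (false ≡ true)
false≢true ()

¬¬-elim-⇔ : {A B : Set} → A ⇔ B → Dec B → ¬ ¬ A → B
¬¬-elim-⇔ A⇔B B? ¬¬A = decidable-stable B? (λ ¬B → ¬¬A (¬B ∘ to A⇔B))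

biimplication-true : ∀ a b → not (not (not a ∨ b) ∨ not (not b ∨ a)) ≡ true ⇔ a ≡ b
biimplication-true true  true  = mk⇔ (λ _ → refl) (λ _ → refl)
biimplication-true true  false = mk⇔ (λ ()) (λ ())
biimplication-true false true  = mk⇔ (λ ()) (λ ())
biimplication-true false false = mk⇔ (λ _ → refl) (λ _ → refl)

module _ {k : ℕ} where

  infixr 25 _∧ᵇ_
  infix  26 _⇔ᵇ_

  _∧ᵇ_ _⇔ᵇ_ : Body k → Body k → Body k
  ψ ∧ᵇ ψ' = neg (or (neg ψ) (neg ψ'))
  ψ ⇔ᵇ ψ' = or (neg ψ) ψ' ∧ᵇ or (neg ψ') ψ

  always : Body k → Body k
  always ψ = neg (event (neg ψ))

  update-at : ∀ (t : Trace k) q tq n → update t q tq n q ≡ tq n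
  update-at t q tq n rewrite dec-true (q ≟ q) refl = refl

-- ∧ and G are encoded with negations, so from their truth only double negations of the
-- components follow; a formula decided by a boolean is stable, which recovers them.
record Decided {k} (T : TraceSet k) (Π : Assignment k) (i : ℕ) (ψ : Body k) (b : Bool) : Set where
  constructor decided
  field decides : (T , Π , i ⊨ᵇ ψ) ⇔ (b ≡ true)

open Decided

module Semantics {k : ℕ} (T : TraceSet k) (Π : Assignment k) {i : ℕ} where

  ∧ᵇ-intro : ∀ {ψ ψ'} → T , Π , i ⊨ᵇ ψ → T , Π , i ⊨ᵇ ψ' → T , Π , i ⊨ᵇ ψ ∧ᵇ ψ'
  ∧ᵇ-intro ⊨ψ ⊨ψ' = [ (λ ¬ψ → ¬ψ ⊨ψ) , (λ ¬ψ' → ¬ψ' ⊨ψ') ]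

  ∧ᵇ-elimˡ : ∀ {ψ ψ'} → T , Π , i ⊨ᵇ ψ ∧ᵇ ψ' → ¬ ¬ (T , Π , i ⊨ᵇ ψ)
  ∧ᵇ-elimˡ ⊨∧ = ⊨∧ ∘ inj₁

  ∧ᵇ-elimʳ : ∀ {ψ ψ'} → T , Π , i ⊨ᵇ ψ ∧ᵇ ψ' → ¬ ¬ (T , Π , i ⊨ᵇ ψ')
  ∧ᵇ-elimʳ ⊨∧ = ⊨∧ ∘ inj₂

  always-intro : ∀ {ψ} → (∀ j → i ≤ j → T , Π , j ⊨ᵇ ψ) → T , Π , i ⊨ᵇ always ψ
  always-intro ⊨ψ (j , i≤j , ¬ψ) = ¬ψ (⊨ψ j i≤j)

  always-elim : ∀ {ψ} → ¬ ¬ (T , Π , i ⊨ᵇ always ψ) → ∀ j → i ≤ j → ¬ ¬ (T , Π , j ⊨ᵇ ψ)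
  always-elim ¬¬⊨G j i≤j ¬ψ = ¬¬⊨G (λ ⊨G → ⊨G (j , i≤j , ¬ψ))

  prop-decided : ∀ {p π t} → Π π ≡ just t → Decided T Π i (prop p π) (t i p)
  prop-decided {p} {t = t} eq =
    decided (subst (λ m → lookupHolds m p i ⇔ (t i p ≡ true)) (sym eq) ⇔-refl)

  neg-decided : ∀ {ψ b} → Decided T Π i ψ b → Decided T Π i (neg ψ) (not b)
  neg-decided {b = true}  (decided d) = decided (mk⇔ (λ ¬ψ → ⊥-elim (¬ψ (from d refl))) (λ ()))
  neg-decided {b = false} (decided d) = decided (mk⇔ (λ _ → refl) (λ _ → false≢true ∘ to d))

  or-decided : ∀ {ψ ψ' a b} → Decided T Π i ψ a → Decided T Π i ψ' b →
               Decided T Π i (or ψ ψ') (a ∨ b)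
  or-decided {a = true}  (decided da) _ = decided (mk⇔ (λ _ → refl) (λ _ → inj₁ (from da refl)))
  or-decided {a = false} (decided da) (decided db) =
    decided (mk⇔ [ ⊥-elim ∘ false≢true ∘ to da , to db ] (inj₂ ∘ from db))

  ⇔ᵇ-decided : ∀ {ψ ψ' a b} → Decided T Π i ψ a → Decided T Π i ψ' b →
               (T , Π , i ⊨ᵇ ψ ⇔ᵇ ψ') ⇔ (a ≡ b)
  ⇔ᵇ-decided {a = a} {b} da db =
    ⇔-trans (decides (neg-decided (or-decided (neg-decided (or-decided (neg-decided da) db))
                                     (neg-decided (or-decided (neg-decided db) da)))))
            (biimplication-true a b)

qvar-decided : ∀ {k} {T : TraceSet k} {Π i q tq t'} → updateSet T q tq t' →
               Decided (updateSet T q tq) Π i (qvar q) (tq i)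
qvar-decided {i = i} {q} {tq} {t'} t'∈@(t , _ , t'≈) = decided (mk⇔
  (λ ⊨q → trans (sym (trans (t'≈ i q) (update-at t q tq i))) (⊨q t' t'∈))
  (λ tqi → λ { t'' (s , _ , t''≈) → trans (t''≈ i q) (trans (update-at s q tq i) tqi) }))

injectiveRetraction⇒HasCardContinuum :
  ∀ {k} {T : TraceSet k} (f : Elem T → (ℕ → Bool)) (g : (ℕ → Bool) → Elem T) →
  (∀ {x y} → x ≈ᵉ y → f x ≈ᶜ f y) → (∀ x y → f x ≈ᶜ f y → x ≈ᵉ y) → (∀ c → f (g c) ≈ᶜ c) →
  HasCardContinuum T
injectiveRetraction⇒HasCardContinuum f g f-cong f-injective f∘g≈id = record
  { to        = f
  ; from      = g
  ; to-cong   = f-cong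
  ; from-cong = λ {c} {d} c≈d → f-injective (g c) (g d) λ n →
                  trans (f∘g≈id c n) (trans (c≈d n) (sym (f∘g≈id d n)))
  ; to-from   = f∘g≈id
  ; from-to   = λ x → f-injective (g (f x)) x (f∘g≈id (f x))
  }

p q : Fin 2
p = zero
q = suc zero

q-absent p-tracks-q : Body 2
q-absent   = always (neg (prop q 0))
p-tracks-q = always (prop p 1 ⇔ᵇ qvar q)

φ-body : Body 2
φ-body = q-absent ∧ᵇ p-tracks-q

φ : Formula 2
φ = ∀π 0 (∀q q (∃π 1 (body φ-body)))

q-free : TraceSet 2
q-free t = ∀ n → t n q ≡ false

assign : Trace 2 → Trace 2 → Assignment 2
assign t₀ t₁ = extend (extend emptyAssign 0 t₀) 1 t₁

⊨φ⇔ : ∀ {T} → (T , emptyAssign , 0 ⊨ φ) ⇔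
      (∀ t₀ → T t₀ → ∀ c → Σ (Trace 2) λ t₁ →
         updateSet T q c t₁ × (updateSet T q c , assign t₀ t₁ , 0 ⊨ᵇ φ-body))
⊨φ⇔ = ⇔-refl

φ-sentence : Sentence φ
φ-sentence = there (here refl) , (here refl , here refl) , (here refl , here refl)

module _ {T : TraceSet 2} {t₀ t₁ : Trace 2} {c : ℕ → Bool} where

  private
    T[c] = updateSet T q c
    Π    = assign t₀ t₁

  open Semantics T[c] Π

  private
    q-off : ∀ n → Decided T[c] Π n (neg (prop q 0)) (not (t₀ n q))
    q-off n = neg-decided (prop-decided refl)

    p⇔q : updateSet T q c t₁ → ∀ n → (T[c] , Π , n ⊨ᵇ prop p 1 ⇔ᵇ qvar q) ⇔ (t₁ n p ≡ c n)
    p⇔q t₁∈ n = ⇔ᵇ-decided {ψ = prop p 1} {qvar q} (prop-decided refl) (qvar-decided t₁∈)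

  ⊨φ-body⇒q-free : T[c] , Π , 0 ⊨ᵇ φ-body → q-free t₀
  ⊨φ-body⇒q-free ⊨body n = not-injective (¬¬-elim-⇔ (decides (q-off n)) (not (t₀ n q) ≟ᴮ true)
    (always-elim {ψ = neg (prop q 0)}
      (∧ᵇ-elimˡ {ψ = q-absent} {p-tracks-q} ⊨body) n z≤n))

  ⊨φ-body⇒p-tracks-c : updateSet T q c t₁ → T[c] , Π , 0 ⊨ᵇ φ-body →
                     ∀ n → t₁ n p ≡ c n
  ⊨φ-body⇒p-tracks-c t₁∈ ⊨body n = ¬¬-elim-⇔ (p⇔q t₁∈ n) (t₁ n p ≟ᴮ c n)
    (always-elim {ψ = prop p 1 ⇔ᵇ qvar q}
      (∧ᵇ-elimʳ {ψ = q-absent} {p-tracks-q} ⊨body) n z≤n)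

  ⊨φ-body-intro : updateSet T q c t₁ → q-free t₀ → (∀ n → t₁ n p ≡ c n) →
                T[c] , Π , 0 ⊨ᵇ φ-body
  ⊨φ-body-intro t₁∈ t₀-q-free t₁-p≡c = ∧ᵇ-intro {ψ = q-absent} {p-tracks-q}
    (always-intro {ψ = neg (prop q 0)} λ n _ →
      from (decides (q-off n)) (cong not (t₀-q-free n)))
    (always-intro {ψ = prop p 1 ⇔ᵇ qvar q} λ n _ → from (p⇔q t₁∈ n) (t₁-p≡c n))

p-component : {T : TraceSet 2} → Elem T → ℕ → Bool
p-component (t , _) n = t n p

p-component-injective : {T : TraceSet 2} → (∀ t → T t → q-free t) →
                        ∀ (x y : Elem T) → p-component x ≈ᶜ p-component y → x ≈ᵉ y
p-component-injective T⊆q-free (_ , x∈T) (_ , y∈T) x≈y n zero = x≈y n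
p-component-injective T⊆q-free (_ , x∈T) (_ , y∈T) x≈y n (suc zero) =
  trans (T⊆q-free _ x∈T n) (sym (T⊆q-free _ y∈T n))

p-surjective⇒HasCardContinuum : {T : TraceSet 2} → (∀ t → T t → q-free t) →
                                (∀ c → Σ (Elem T) λ x → p-component x ≈ᶜ c) → HasCardContinuum T
p-surjective⇒HasCardContinuum T⊆q-free surjective = injectiveRetraction⇒HasCardContinuum
  p-component (proj₁ ∘ surjective) (λ x≈y n → x≈y n p)
  (p-component-injective T⊆q-free) (proj₂ ∘ surjective)

model⊆q-free : ∀ {T : TraceSet 2} → Model T φ → ∀ t → T t → q-free t
model⊆q-free {T} (_ , ⊨φ) t t∈T with to ⊨φ⇔ ⊨φ t t∈T (λ _ → false)
... | t₁ , _ , ⊨body = ⊨φ-body⇒q-free {T} {t} {t₁} ⊨body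

model⇒p-surjective : ∀ {T : TraceSet 2} → Model T φ →
                     (c : ℕ → Bool) → Σ (Elem T) λ x → p-component x ≈ᶜ c
model⇒p-surjective {T} ((t₀ , t₀∈T) , ⊨φ) c with to ⊨φ⇔ ⊨φ t₀ t₀∈T c
... | t₁ , t₁∈@(t , t∈T , t₁≈) , ⊨body = (t , t∈T) , λ n →
  trans (sym (t₁≈ n p)) (⊨φ-body⇒p-tracks-c {t₀ = t₀} t₁∈ ⊨body n)

with-p-component : (ℕ → Bool) → Trace 2
with-p-component c n zero       = c n
with-p-component c n (suc zero) = false

q-free-model : Model q-free φ
q-free-model = (with-p-component (λ _ → false) , λ _ → refl) , from ⊨φ⇔ λ t₀ t₀∈ c →
  let t₁∈ = with-p-component c , (λ _ → refl) , (λ _ _ → refl)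
  in update (with-p-component c) q c , t₁∈ , ⊨φ-body-intro {t₀ = t₀} t₁∈ t₀∈ (λ _ → refl)

theorem1 : Σ ℕ λ n → Σ (Formula (suc n)) λ φ →
    Sentence φ
    × Σ (TraceSet (suc n)) (λ T → Model T φ)
    × ((T : TraceSet (suc n)) → Model T φ → HasCardContinuum T)
theorem1 = 1 , φ , φ-sentence , (q-free , q-free-model) , λ T ⊨φ →
  p-surjective⇒HasCardContinuum (model⊆q-free ⊨φ) (model⇒p-surjective ⊨φ)
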